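{- Let $s$ be a string over a finite alphabet $\Sigma$ and let $p$ be a positive integer that is a parameterized period of $s$. For any substring $s'$ of $s$, if $|s'| \ge p\cdot(|\Sigma_s|-2)+1$, then $|\Sigma_{s'}| \ge |\Sigma_s|-1$.
   Context: For a string $w$, $\Sigma_w$ denotes the set of distinct characters occurring in $w$. Two strings $x,y$ of equal length $k$ are parameterized equivalent, written $x\approx y$, if there is a bijection $f:\Sigma\to\Sigma$ with $f(x[i])=y[i]$ for all $1\le i\le k$. A positive integer $p$ is a parameterized period of $s$ if $s[1..|s|-p] \approx s[p+1..|s|]$, i.e., there is a bijection $f$ of $\Sigma$ with $f(s[i]) = s[i+p]$ for all $1 \le i \le |s|-p$. -}

module Defs where

open import Data.Nat using (ℕ; _∸_)
open import Data.Fin using (Fin)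
open import Data.Fin.Properties using (_≟_)
open import Data.List using (List; length; filter; take; drop; map; _++_; allFin)
open import Data.List.Membership.DecPropositional using (_∈?_)
open import Data.Fin.Permutation using (Permutation′; _⟨$⟩ʳ_)
open import Data.Product using (∃; ∃-syntax; _×_)
open import Relation.Binary.PropositionalEquality using (_≡_)

Str : ℕ → Set
Str k = List (Fin k)

alph : ∀ {k} → Str k → ℕ
alph {k} w = length (filter (λ c → _∈?_ (_≟_ {k}) c w) (allFin k))

-- p is a parameterized period of s: there is a bijection f of Σ with
-- f (s[i]) = s[i+p] for all 1 ≤ i ≤ |s| - p, i.e.
-- f applied to s[1..|s|-p] equals s[p+1..|s|].
IsPPeriod : ∀ {k} → ℕ → Str k → Set
IsPPeriod {k} p s =
  ∃[ f ] map (f ⟨$⟩ʳ_) (take (length s ∸ p) s) ≡ drop p s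

IsSubstring : ∀ {k} → Str k → Str k → Set
IsSubstring {k} s' s = ∃[ u ] ∃[ v ] s ≡ u ++ (s' ++ v)

{-# OPTIONS --safe #-}
-- Let f be the bijection of the period, so that s[i + p] = f (s[i]) wherever both sides exist.
-- Inside s′ consider the windows W_j of length p·j + 1 starting where s′ starts. If every
-- extension W_j ⊂ W_(j+1) brings a new letter, W_j has at least j + 1 letters. If some
-- extension brings none, the letter set X of W_j is mapped into itself by f, because the
-- letters p places to the right of W_j lie in W_(j+1); as f permutes a finite alphabet, X is
-- then closed under f⁻¹ as well. Since X also contains p consecutive letters of s, the relation
-- s[i + p] = f (s[i]) propagates membership in X to every position of s, so X = Σ_s.
-- Taking j = |Σ_s| - 2 gives the bound.
module Submission where

open import Defs
open import Level using (0ℓ)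
open import Data.Nat using (ℕ; zero; suc; _+_; _*_; _∸_; _≤_; _≥_; _<_; s≤s; z<s; s<s; _≤?_; _<?_; >-nonZero)
open import Data.Nat.Properties hiding (_≟_)
open import Data.Nat.Induction using (<-rec)
open import Data.Fin using (Fin)
open import Data.Fin.Properties using (_≟_)
open import Data.Fin.Permutation using (Permutation′; _⟨$⟩ʳ_)
open import Data.List using (List; []; _∷_; length; filter; take; drop; map; _++_; allFin; tabulate)
open import Data.List.Properties using (length-++; filter-some)
open import Data.List.Membership.Propositional using (_∈_; lose)
open import Data.List.Membership.Propositional.Properties using (∈-allFin; ∈-filter⁺; ∈-filter⁻)
open import Data.List.Membership.DecPropositional using (_∈?_)
open import Data.List.Relation.Unary.Any using (here; there)
open import Data.List.Relation.Binary.Subset.Propositional using (_⊆_)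
open import Data.List.Relation.Binary.Subset.Propositional.Properties using (⊆-trans)
import Data.List.Relation.Binary.Sublist.Propositional as Sublist
import Data.List.Relation.Binary.Sublist.Propositional.Properties as Sublist
open import Data.List.Relation.Binary.Pointwise using (Pointwise-≡⇒≡)
open import Data.Maybe as Maybe using (Maybe; just; nothing)
open import Data.Product as Product using (∃-syntax; _×_; _,_; proj₁; proj₂)
open import Data.Sum using (_⊎_; inj₁; inj₂)
open import Function using (id; _∘_)
open import Relation.Nullary using (Dec; yes; no; contradiction)
open import Relation.Unary using (Pred; Decidable)
open import Relation.Binary.PropositionalEquality using (_≡_; refl; sym; trans; cong; subst; module ≡-Reasoning)
open import Algebra.Properties.CommutativeMonoid.Sum +-0-commutativeMonoid using (sum; ∑-permute)

private
  variable
    A B : Set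
    x : A
    xs ys : List A
    i : ℕ

infixl 20 _!_
_!_ : List A → ℕ → Maybe A
[] ! _ = nothing
(x ∷ xs) ! zero = just x
(x ∷ xs) ! suc i = xs ! i

!-drop : ∀ n (xs : List A) i → drop n xs ! i ≡ xs ! (n + i)
!-drop zero xs i = refl
!-drop (suc n) [] i = refl
!-drop (suc n) (x ∷ xs) i = !-drop n xs i

!-take : ∀ m (xs : List A) → i < m → take m xs ! i ≡ xs ! i
!-take (suc m) [] _ = refl
!-take {i = zero} (suc m) (x ∷ xs) _ = refl
!-take {i = suc i} (suc m) (x ∷ xs) (s<s i<m) = !-take m xs i<m

!-take⁻ : ∀ m (xs : List A) i → take m xs ! i ≡ just x → i < m × xs ! i ≡ just x
!-take⁻ (suc m) (y ∷ xs) zero e = z<s , e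
!-take⁻ (suc m) (y ∷ xs) (suc i) e = Product.map₁ s<s (!-take⁻ m xs i e)

!-map : ∀ (f : A → B) xs i → map f xs ! i ≡ Maybe.map f (xs ! i)
!-map f [] i = refl
!-map f (x ∷ xs) zero = refl
!-map f (x ∷ xs) (suc i) = !-map f xs i

!-++ʳ : ∀ (xs : List A) → (xs ++ ys) ! (length xs + i) ≡ ys ! i
!-++ʳ [] = refl
!-++ʳ (x ∷ xs) = !-++ʳ xs

!-++ˡ : ∀ (xs : List A) → i < length xs → (xs ++ ys) ! i ≡ xs ! i
!-++ˡ {i = zero} (x ∷ xs) _ = refl
!-++ˡ {i = suc i} (x ∷ xs) (s<s i<n) = !-++ˡ xs i<n

!-defined : ∀ (xs : List A) i → i < length xs → ∃[ x ] xs ! i ≡ just x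
!-defined (x ∷ xs) zero _ = x , refl
!-defined (x ∷ xs) (suc i) (s<s i<n) = !-defined xs i i<n

∈⇒! : x ∈ xs → ∃[ i ] xs ! i ≡ just x
∈⇒! (here refl) = zero , refl
∈⇒! (there x∈xs) = Product.map suc id (∈⇒! x∈xs)

!⇒∈ : ∀ (xs : List A) i → xs ! i ≡ just x → x ∈ xs
!⇒∈ (y ∷ xs) zero refl = here refl
!⇒∈ (y ∷ xs) (suc i) e = there (!⇒∈ xs i e)

window : List A → ℕ → ℕ → List A
window xs a m = take m (drop a xs)

∈-window⁻ : ∀ (xs : List A) a m → x ∈ window xs a m → ∃[ d ] d < m × xs ! (a + d) ≡ just x
∈-window⁻ xs a m x∈w with ∈⇒! x∈w
... | d , e with !-take⁻ m (drop a xs) d e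
...   | d<m , e′ = d , d<m , trans (sym (!-drop a xs d)) e′

∈-window⁺ : ∀ (xs : List A) a {m d} → d < m → xs ! (a + d) ≡ just x → x ∈ window xs a m
∈-window⁺ xs a {m} {d} d<m e =
  !⇒∈ (window xs a m) d (trans (!-take m (drop a xs) d<m) (trans (!-drop a xs d) e))

window-mono : ∀ (xs : List A) a {m n} → m ≤ n → window xs a m ⊆ window xs a n
window-mono xs a {m} m≤n x∈w with ∈-window⁻ xs a m x∈w
... | d , d<m , e = ∈-window⁺ xs a (<-≤-trans d<m m≤n) e

window-nonempty : ∀ (xs : List A) a {m} → a < length xs → 0 < m → ∃[ x ] x ∈ window xs a m
window-nonempty xs a a<n 0<m with !-defined xs a a<n
... | x , e = x , ∈-window⁺ xs a 0<m (trans (cong (xs !_) (+-identityʳ a)) e)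

module _ (u w v : List A) {m : ℕ} (m≤w : m ≤ length w) where

  infix-window-fits : length u + m ≤ length (u ++ w ++ v)
  infix-window-fits = begin
    length u + m                      ≤⟨ +-monoʳ-≤ (length u) (≤-trans m≤w (m≤m+n _ (length v))) ⟩
    length u + (length w + length v)  ≡⟨ cong (length u +_) (length-++ w) ⟨
    length u + length (w ++ v)        ≡⟨ length-++ u ⟨
    length (u ++ w ++ v)              ∎
    where open ≤-Reasoning

  infix-window-⊆ : window (u ++ w ++ v) (length u) m ⊆ w
  infix-window-⊆ x∈win with ∈-window⁻ (u ++ w ++ v) (length u) m x∈win
  ... | d , d<m , e = !⇒∈ w d (begin
    w ! d                             ≡⟨ !-++ˡ w (<-≤-trans d<m m≤w) ⟨
    (w ++ v) ! d                      ≡⟨ !-++ʳ u ⟨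
    (u ++ w ++ v) ! (length u + d)    ≡⟨ e ⟩
    just _                            ∎)
    where open ≡-Reasoning

indicator : ∀ {P : Set} → Dec P → ℕ
indicator (yes _) = 1
indicator (no _) = 0

length-filter-tabulate : ∀ {P : Pred A 0ℓ} (P? : Decidable P) {n} (g : Fin n → A) →
  length (filter P? (tabulate g)) ≡ sum (λ i → indicator (P? (g i)))
length-filter-tabulate P? {zero} g = refl
length-filter-tabulate P? {suc n} g with P? (g Fin.zero)
... | yes _ = cong suc (length-filter-tabulate P? (g ∘ Fin.suc))
... | no _ = length-filter-tabulate P? (g ∘ Fin.suc)

module _ {k : ℕ} where

  count : {P : Pred (Fin k) 0ℓ} → Decidable P → ℕ
  count P? = length (filter P? (allFin k))

  module _ {P Q : Pred (Fin k) 0ℓ} (P? : Decidable P) (Q? : Decidable Q)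
           (P⊆Q : ∀ {c} → P c → Q c) where

    filter-Sublist-filter : filter P? (allFin k) Sublist.⊆ filter Q? (allFin k)
    filter-Sublist-filter = Sublist.filter⁺ P? Q? {as = allFin k} (λ { refl → P⊆Q }) Sublist.⊆-refl

    count-mono : count P? ≤ count Q?
    count-mono = Sublist.length-mono-≤ filter-Sublist-filter

    count-≥⇒⊇ : count Q? ≤ count P? → ∀ {c} → Q c → P c
    count-≥⇒⊇ Q≤P {c} Qc = proj₂ (∈-filter⁻ P? {xs = allFin k} c∈filter-P)
      where
      same : filter P? (allFin k) ≡ filter Q? (allFin k)
      same = Pointwise-≡⇒≡ (Sublist.to-≋ (≤-antisym count-mono Q≤P) filter-Sublist-filter)

      c∈filter-P : c ∈ filter P? (allFin k)
      c∈filter-P = subst (c ∈_) (sym same) (∈-filter⁺ Q? (∈-allFin c) Qc)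

  count-permute : ∀ {P : Pred (Fin k) 0ℓ} (P? : Decidable P) (π : Permutation′ k) →
    count (P? ∘ (π ⟨$⟩ʳ_)) ≡ count P?
  count-permute P? π = begin
    count (P? ∘ (π ⟨$⟩ʳ_))                   ≡⟨ length-filter-tabulate (P? ∘ (π ⟨$⟩ʳ_)) id ⟩
    sum (λ c → indicator (P? (π ⟨$⟩ʳ c)))     ≡⟨ ∑-permute (indicator ∘ P?) π ⟨
    sum (λ c → indicator (P? c))             ≡⟨ length-filter-tabulate P? id ⟨
    count P?                                 ∎
    where open ≡-Reasoning

  preserves⇒reflects : ∀ {P : Pred (Fin k) 0ℓ} (P? : Decidable P) (π : Permutation′ k) →
    (∀ {c} → P c → P (π ⟨$⟩ʳ c)) → ∀ {c} → P (π ⟨$⟩ʳ c) → P c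
  preserves⇒reflects P? π preserves =
    count-≥⇒⊇ P? (P? ∘ (π ⟨$⟩ʳ_)) preserves (≤-reflexive (count-permute P? π))

  ∈?[_] : (w : Str k) → Decidable (_∈ w)
  ∈?[ w ] c = _∈?_ _≟_ c w

  alph-mono : {w w′ : Str k} → w ⊆ w′ → alph w ≤ alph w′
  alph-mono {w} {w′} w⊆w′ = count-mono ∈?[ w ] ∈?[ w′ ] w⊆w′

  alph-≥⇒⊇ : {w w′ : Str k} → w ⊆ w′ → alph w′ ≤ alph w → w′ ⊆ w
  alph-≥⇒⊇ {w} {w′} w⊆w′ = count-≥⇒⊇ ∈?[ w ] ∈?[ w′ ] w⊆w′

  alph-pos : {w : Str k} {c : Fin k} → c ∈ w → 0 < alph w
  alph-pos {w} {c} c∈w = filter-some ∈?[ w ] (lose (∈-allFin c) c∈w)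

m*[1+n]+1≡m*n+1+m : ∀ m n → m * suc n + 1 ≡ m * n + 1 + m
m*[1+n]+1≡m*n+1+m m n =
  trans (cong (_+ 1) (*-suc m n)) (trans (+-assoc m (m * n) 1) (+-comm m (m * n + 1)))

module Periodic {k : ℕ} (s : Str k) {p : ℕ} (period : IsPPeriod p s) where

  π : Permutation′ k
  π = proj₁ period

  f : Fin k → Fin k
  f = π ⟨$⟩ʳ_

  !-period : ∀ i → s ! (i + p) ≡ Maybe.map f (take (length s ∸ p) s ! i)
  !-period i = begin
    s ! (i + p)                              ≡⟨ cong (s !_) (+-comm i p) ⟩
    s ! (p + i)                              ≡⟨ !-drop p s i ⟨
    drop p s ! i                             ≡⟨ cong (_! i) (proj₂ period) ⟨
    map f (take (length s ∸ p) s) ! i        ≡⟨ !-map f (take (length s ∸ p) s) i ⟩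
    Maybe.map f (take (length s ∸ p) s ! i)  ∎
    where open ≡-Reasoning

  !-period⁺ : ∀ {i c} → i + p < length s → s ! i ≡ just c → s ! (i + p) ≡ just (f c)
  !-period⁺ {i} fits e =
    trans (!-period i) (cong (Maybe.map f) (trans (!-take (length s ∸ p) s (m+n≤o⇒m≤o∸n (suc i) fits)) e))

  !-period⁻ : ∀ {i d} → s ! (i + p) ≡ just d → ∃[ c ] s ! i ≡ just c × f c ≡ d
  !-period⁻ {i} e with take (length s ∸ p) s ! i in t | trans (sym (!-period i)) e
  ... | just c | refl = c , proj₂ (!-take⁻ (length s ∸ p) s i t) , refl

  Covered : Pred (Fin k) 0ℓ → ℕ → Set
  Covered P i = ∀ {c} → s ! i ≡ just c → P c

  module _ {P : Pred (Fin k) 0ℓ}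
           (preserves : ∀ {c} → P c → P (f c)) (reflects : ∀ {c} → P (f c) → P c) where

    covered-+p : Covered P i → Covered P (i + p)
    covered-+p cov e with !-period⁻ e
    ... | c , e′ , refl = preserves (cov e′)

    covered-+p⁻ : i + p < length s → Covered P (i + p) → Covered P i
    covered-+p⁻ fits cov e = reflects (cov (!-period⁺ fits e))

    module _ (p≥1 : 1 ≤ p) {a : ℕ} (block-fits : a + p ≤ length s)
             (block : ∀ {t} → t < p → Covered P (a + t)) where

      covered-above : ∀ t → Covered P (a + t)
      covered-above = <-rec (Covered P ∘ (a +_)) step
        where
        step : ∀ t → (∀ {t′} → t′ < t → Covered P (a + t′)) → Covered P (a + t)
        step t rec with t <? p
        ... | yes t<p = block t<p
        ... | no t≮p = subst (Covered P) shift (covered-+p (rec (∸-monoʳ-< p≥1 p≤t)))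
          where
          p≤t = ≮⇒≥ t≮p
          shift : a + (t ∸ p) + p ≡ a + t
          shift = trans (+-assoc a (t ∸ p) p) (cong (a +_) (m∸n+n≡m p≤t))

      covered-below : ∀ d → a ≤ i + d * p → Covered P i
      covered-below {i} d a≤ with a ≤? i
      ... | yes a≤i = subst (Covered P) (m+[n∸m]≡n a≤i) (covered-above (i ∸ a))
      covered-below {i} zero a≤ | no a≰i = contradiction (subst (a ≤_) (+-identityʳ i) a≤) a≰i
      covered-below {i} (suc d) a≤ | no a≰i =
        covered-+p⁻ (<-≤-trans (+-monoˡ-< p (≰⇒> a≰i)) block-fits)
                    (covered-below d (subst (a ≤_) (sym (+-assoc i p (d * p))) a≤))

      block-covers : ∀ {c} → c ∈ s → P c
      block-covers c∈s with ∈⇒! c∈s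
      ... | i , e = covered-below a (≤-trans (m≤m*n a p {{>-nonZero p≥1}}) (m≤n+m _ i)) e

  window-saturated : 1 ≤ p → ∀ {a m} → a + (m + p) ≤ length s →
    window s a (m + p) ⊆ window s a m → s ⊆ window s a m
  window-saturated p≥1 {a} {m} fits saturated =
    block-covers preserves (preserves⇒reflects ∈?[ X ] π preserves) p≥1 block-fits block
    where
    X = window s a m

    preserves : ∀ {c} → c ∈ X → f c ∈ X
    preserves {c} c∈X with ∈-window⁻ s a m c∈X
    ... | d , d<m , e = saturated (∈-window⁺ s a (+-monoˡ-< p d<m)
      (subst (λ i → s ! i ≡ just (f c)) (+-assoc a d p) (!-period⁺ shifted-fits e)))
      where
      shifted-fits : a + d + p < length s
      shifted-fits = <-≤-trans (+-monoˡ-< p (+-monoʳ-< a d<m))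
                               (≤-trans (≤-reflexive (+-assoc a m p)) fits)

    block-fits : a + p ≤ length s
    block-fits = ≤-trans (+-monoʳ-≤ a (m≤n+m p m)) fits

    block : ∀ {t} → t < p → Covered (_∈ X) (a + t)
    block t<p e = saturated (∈-window⁺ s a (<-≤-trans t<p (m≤n+m p m)) e)

  window-growth : 1 ≤ p → ∀ a j → a + (p * j + 1) ≤ length s →
    suc j ≤ alph (window s a (p * j + 1)) ⊎ s ⊆ window s a (p * j + 1)
  window-growth p≥1 a zero fits rewrite *-zeroʳ p =
    inj₁ (alph-pos (proj₂ (window-nonempty s a (subst (_≤ length s) (+-comm a 1) fits) z<s)))
  window-growth p≥1 a (suc j) fits rewrite m*[1+n]+1≡m*n+1+m p j
    with window-growth p≥1 a j (≤-trans (+-monoʳ-≤ a (m≤m+n (p * j + 1) p)) fits)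
  ... | inj₂ s⊆W = inj₂ (⊆-trans s⊆W (window-mono s a (m≤m+n _ p)))
  ... | inj₁ grown with alph (window s a (p * j + 1 + p)) ≤? alph (window s a (p * j + 1))
  ...   | yes no-new = inj₂ (⊆-trans (window-saturated p≥1 {a} fits (alph-≥⇒⊇ W⊆W′ no-new)) W⊆W′)
    where W⊆W′ = window-mono s a (m≤m+n (p * j + 1) p)
  ...   | no new = inj₁ (≤-trans (s≤s grown) (≰⇒> new))

n∸1≤1+[n∸2] : ∀ n → n ∸ 1 ≤ suc (n ∸ 2)
n∸1≤1+[n∸2] n = subst (λ x → n ∸ 1 ≤ suc x) (∸-+-assoc n 1 1) (m≤n+m∸n (n ∸ 1) 1)

corollary9 : (k : ℕ) (s : Str k) (p : ℕ) → 1 ≤ p → IsPPeriod p s →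
    (s′ : Str k) → IsSubstring s′ s →
    length s′ ≥ p * (alph s ∸ 2) + 1 →
    alph s′ ≥ alph s ∸ 1
corollary9 k s p p≥1 period s′ (u , v , refl) long
  with Periodic.window-growth s period p≥1 (length u) (alph s ∸ 2) (infix-window-fits u s′ v long)
... | inj₁ grown =
  ≤-trans (n∸1≤1+[n∸2] (alph s)) (≤-trans grown (alph-mono (infix-window-⊆ u s′ v long)))
... | inj₂ s⊆W =
  ≤-trans (m∸n≤m (alph s) 1) (alph-mono (⊆-trans s⊆W (infix-window-⊆ u s′ v long)))
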